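{- Let $r=\langle L\leftarrow K\rightarrow R\rangle$ be a rule in which $L$ and $R$ are totally labelled graphs and $K$ is partially labelled. Then for all totally labelled graphs $G,H$ over $\mathcal{L}$: $G\Rightarrow_r H$ if and only if $e(G)\Rightarrow_{e(r)}e(H)$, where $e(r)=\langle e(L)\leftarrow e(K)\rightarrow e(R)\rangle$ with the encoded inclusions.
   Context: Let $\mathcal{L}=(\mathcal{L}_V,\mathcal{L}_E)$ be a label alphabet of finite sets with $\mathcal{L}_V\cap\mathcal{L}_E=\emptyset$ and $\square\notin\mathcal{L}_V\cup\mathcal{L}_E$. A partially labelled graph is $G=(V,E,s,t,l,m)$ with finite $V,E$, total $s,t:E\to V$, partial node labelling $l:V\to\mathcal{L}_V$ and total edge labelling $m:E\to\mathcal{L}_E$; it is totally labelled if $l$ is total. Morphisms preserve sources, targets, edge labels, and node labels where defined in the domain. A rule $\langle L\leftarrow K\rightarrow R\rangle$ has $K$ a subgraph of $L$ and $R$ (inclusions). Application of a rule to a totally labelled $G$ via injective $g:L\to G$ satisfying the dangling condition (no edge outside $g(L)$ incident to $g(V_L\setminus V_K)$): delete $g(L\setminus K)$, make $g_V(v)$ unlabelled for every node $v\in V_K$ unlabelled in $K$; add disjointly $R\setminus K$ with labels and label each such $g_V(v)$ by $l_R(v)$; $G\Rightarrow_r M$ iff $M$ is isomorphic to the result for some such $g$. (When all graphs are totally labelled, this is ordinary DPO rewriting.) Encoding: for a partially labelled $G$ (assuming $V_G\cap E_G=\emptyset$) let $e(G)=(V,E,s,t,l,m)$ with $V=V_G$,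 $E=E_G\cup\{v\in V_G\mid l_G(v)\text{ defined}\}$, $s(e)=s_G(e),t(e)=t_G(e)$ for $e\in E_G$ and $s(v)=t(v)=v$ for the added loops $v$, $l(v)=\square$ for all nodes, $m(e)=m_G(e)$ for $e\in E_G$ and $m(v)=l_G(v)$ for added loops. This is a totally labelled graph over $e(\mathcal{L})=(\{\square\},\mathcal{L}_V\cup\mathcal{L}_E)$. For a morphism $g:G\to H$, $e(g)=(g'_V,g'_E)$ with $g'_V=g_V$, $g'_E(e)=g_E(e)$ for $e\in E_G$ and $g'_E(v)=g_V(v)$ for added loops $v$. -}

module Defs where

open import Data.Nat using (ℕ)
open import Data.Fin using (Fin)
open import Data.Maybe using (Maybe; just; nothing; is-just)
open import Data.Bool using (T)
open import Data.Unit using (⊤; tt)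
open import Data.Empty using (⊥)
open import Data.Sum using (_⊎_; inj₁; inj₂)
open import Data.Product using (Σ; ∃; _×_; _,_; proj₁; proj₂; ∃-syntax)
open import Relation.Binary.PropositionalEquality using (_≡_; _≢_; refl; subst; sym)
open import Relation.Nullary using (¬_)
open import Function.Bundles using (_↔_)
open import Function.Definitions using (Injective)

record Graph (NL EL : Set) : Set₁ where
  field
    V E : Set
    s t : E → V
    l   : V → Maybe NL
    m   : E → EL
open Graph public

Finite : Set → Set
Finite A = Σ ℕ λ n → A ↔ Fin n

FiniteGraph : ∀ {NL EL} → Graph NL EL → Set
FiniteGraph G = Finite (V G) × Finite (E G)

TotallyLabelled : ∀ {NL EL} → Graph NL EL → Set
TotallyLabelled G = ∀ v → ∃[ a ] (l G v ≡ just a)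

record GMap {NL EL : Set} (G H : Graph NL EL) : Set where
  constructor gmap
  field
    fV : V G → V H
    fE : E G → E H
open GMap public

record IsMorphism {NL EL : Set} {G H : Graph NL EL} (f : GMap G H) : Set where
  field
    pres-s : ∀ e → s H (fE f e) ≡ fV f (s G e)
    pres-t : ∀ e → t H (fE f e) ≡ fV f (t G e)
    pres-m : ∀ e → m H (fE f e) ≡ m G e
    pres-l : ∀ v a → l G v ≡ just a → l H (fV f v) ≡ just a

-- injective morphisms (inclusions up to renaming)
record IsInjMorphism {NL EL : Set} {G H : Graph NL EL} (f : GMap G H) : Set where
  field
    morphism : IsMorphism f
    injV     : Injective _≡_ _≡_ (fV f)
    injE     : Injective _≡_ _≡_ (fE f)

record Rule (NL EL : Set) : Set₁ where
  field
    L K R : Graph NL EL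
    i : GMap K L
    j : GMap K R
open Rule public

IsRule : ∀ {NL EL} → Rule NL EL → Set
IsRule r = IsInjMorphism (i r) × IsInjMorphism (j r)

-- Rule application  G ⇒[ r ] M : there is an injective morphism
-- g : L → G satisfying the dangling condition such that M is isomorphic
-- to the graph obtained by deleting g(L∖K), unlabelling g(v) for nodes v
-- unlabelled in K, gluing in R∖K and labelling g(v) by l_R(v).
-- The nodes (edges) of the result are the kept nodes (edges) of G
-- together with the nodes (edges) of R∖K, i.e. a subset of V G ⊎ V R
-- (E G ⊎ E R); the isomorphism is given by injective maps φV, φE from M
-- onto exactly these subsets, preserving the structure.

module _ {NL EL : Set} (r : Rule NL EL) (G : Graph NL EL) (g : GMap (L r) G) where

  private
    iV = fV (i r)
    iE = fE (i r)
    jV = fV (j r)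
    jE = fE (j r)
    gV = fV g
    gE = fE g

  DeletedV : V G → Set
  DeletedV v = ∃[ x ] (gV x ≡ v × (∀ k → iV k ≢ x))

  DeletedE : E G → Set
  DeletedE e = ∃[ x ] (gE x ≡ e × (∀ k → iE k ≢ x))

  Dangling : Set
  Dangling = ∀ e → (∀ x → gE x ≢ e) → ¬ DeletedV (s G e) × ¬ DeletedV (t G e)

  KeptV : V G ⊎ V (R r) → Set
  KeptV (inj₁ v) = ¬ DeletedV v
  KeptV (inj₂ w) = ∀ k → jV k ≢ w

  KeptE : E G ⊎ E (R r) → Set
  KeptE (inj₁ e) = ¬ DeletedE e
  KeptE (inj₂ e) = ∀ k → jE k ≢ e

  EmbR : V (R r) → V G ⊎ V (R r) → Set
  EmbR w y = (∃[ k ] (jV k ≡ w × y ≡ inj₁ (gV (iV k))))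
           ⊎ ((∀ k → jV k ≢ w) × y ≡ inj₂ w)

  SrcRel : E G ⊎ E (R r) → V G ⊎ V (R r) → Set
  SrcRel (inj₁ e) y = y ≡ inj₁ (s G e)
  SrcRel (inj₂ e) y = EmbR (s (R r) e) y

  TgtRel : E G ⊎ E (R r) → V G ⊎ V (R r) → Set
  TgtRel (inj₁ e) y = y ≡ inj₁ (t G e)
  TgtRel (inj₂ e) y = EmbR (t (R r) e) y

  LabRel : V G ⊎ V (R r) → Maybe NL → Set
  LabRel (inj₁ v) a =
      (∀ k → gV (iV k) ≡ v → l (K r) k ≡ nothing → a ≡ l (R r) (jV k))
    × (¬ (∃[ k ] (gV (iV k) ≡ v × l (K r) k ≡ nothing)) → a ≡ l G v)
  LabRel (inj₂ w) a = a ≡ l (R r) w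

  edgeLab : E G ⊎ E (R r) → EL
  edgeLab (inj₁ e) = m G e
  edgeLab (inj₂ e) = m (R r) e

record _⇒[_]_ {NL EL : Set} (G : Graph NL EL) (r : Rule NL EL) (M : Graph NL EL) : Set where
  field
    total    : TotallyLabelled G
    g        : GMap (L r) G
    g-mor    : IsMorphism g
    g-injV   : Injective _≡_ _≡_ (fV g)
    g-injE   : Injective _≡_ _≡_ (fE g)
    dangling : Dangling r G g
    φV       : V M → V G ⊎ V (R r)
    φE       : E M → E G ⊎ E (R r)
    φV-inj   : Injective _≡_ _≡_ φV
    φE-inj   : Injective _≡_ _≡_ φE
    φV-onto  : ∀ x → KeptV r G g x → ∃[ v ] (φV v ≡ x)
    φV-into  : ∀ v → KeptV r G g (φV v)
    φE-onto  : ∀ x → KeptE r G g x → ∃[ e ] (φE e ≡ x)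
    φE-into  : ∀ e → KeptE r G g (φE e)
    φ-s      : ∀ e → SrcRel r G g (φE e) (φV (s M e))
    φ-t      : ∀ e → TgtRel r G g (φE e) (φV (t M e))
    φ-l      : ∀ v → LabRel r G g (φV v) (l M v)
    φ-m      : ∀ e → m M e ≡ edgeLab r G g (φE e)

-- Encoding.  The encoded alphabet is e(𝓛) = ({□}, 𝓛_V ∪ 𝓛_E), rendered as
-- (⊤, LV ⊎ LE) with □ = tt (disjointness is built in).

fromJust : ∀ {A : Set} (x : Maybe A) → T (is-just x) → A
fromJust (just a) _ = a

LabNodes : ∀ {NL EL} → Graph NL EL → Set
LabNodes G = Σ (V G) (λ v → T (is-just (l G v)))

enc : ∀ {LV LE : Set} → Graph LV LE → Graph ⊤ (LV ⊎ LE)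
enc G = record
  { V = V G
  ; E = E G ⊎ LabNodes G
  ; s = λ { (inj₁ e) → s G e ; (inj₂ (v , _)) → v }
  ; t = λ { (inj₁ e) → t G e ; (inj₂ (v , _)) → v }
  ; l = λ _ → just tt
  ; m = λ { (inj₁ e) → inj₂ (m G e) ; (inj₂ (v , p)) → inj₁ (fromJust (l G v) p) }
  }

labDef : ∀ {A : Set} {x y : Maybe A} → (∀ a → x ≡ just a → y ≡ just a)
       → T (is-just x) → T (is-just y)
labDef {x = just a} f _ = subst (λ z → T (is-just z)) (sym (f a refl)) tt

encMap : ∀ {LV LE : Set} {G H : Graph LV LE} (f : GMap G H) → IsMorphism f
       → GMap (enc G) (enc H)
encMap f mor = gmap (fV f)
  (λ { (inj₁ e) → inj₁ (fE f e)
     ; (inj₂ (v , p)) → inj₂ (fV f v , labDef (IsMorphism.pres-l mor v) p) })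

encRule : ∀ {LV LE : Set} (r : Rule LV LE) → IsRule r → Rule ⊤ (LV ⊎ LE)
encRule r (ri , rj) = record
  { L = enc (L r) ; K = enc (K r) ; R = enc (R r)
  ; i = encMap (i r) (IsInjMorphism.morphism ri)
  ; j = encMap (j r) (IsInjMorphism.morphism rj)
  }

module Submission where

-- Rewriting totally labelled graphs with a partially labelled interface K
-- is simulated by ordinary rewriting of their encodings, in which every
-- node label becomes a loop carrying that label and nodes are labelled □.
--
-- The node sets of G and e(G) coincide, and the edges of e(G) are the edges
-- of G together with one loop per labelled node.  Hence:
--   * a morphism e(L) → e(G) is exactly the encoding of a morphism L → G
--     (edges go to edges and loops to loops, by their labels), and the two
--     agree on deleted nodes, kept edges, dangling condition and injectivity
--     (module EncodedMatch, used in both directions);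
--   * the edges of e(result) are the embedded edges of the result plus the
--     kept loops, and a loop at a node of the result is kept exactly when it
--     carries that node's label in the result: the loop at g(i(k)) is
--     deleted iff k is unlabelled in K, where the label then comes from R.

open import Defs
open import Function.Bundles using (_⇔_; mk⇔; Equivalence; Inverse)
open import Function.Properties.Inverse using (↔⇒↣)
open import Function.Definitions using (Injective)
open import Data.Fin.Properties using (any?; inj⇒≟)
open import Data.Maybe using (Maybe; just; nothing; is-just)
open import Data.Bool using (T)
open import Data.Bool.Properties using (T-irrelevant)
open import Data.Unit using (⊤; tt)
open import Data.Empty using (⊥-elim)
open import Data.Sum using (_⊎_; inj₁; inj₂)
open import Data.Sum.Properties using (inj₁-injective; inj₂-injective)
open import Data.Product using (Σ; ∃; _×_; _,_; proj₁; proj₂; ∃-syntax; Σ-syntax)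
open import Relation.Binary.PropositionalEquality
open import Relation.Nullary using (¬_; Dec; yes; no)
open import Relation.Nullary.Decidable using (_×-dec_)
open Equivalence using (to; from)

-- Definedness witnesses are irrelevant: labelled nodes are equal as soon
-- as the underlying nodes are.
labNode-≡ : ∀ {A N : Set} {f : A → Maybe N} {a b : A}
              {p : T (is-just (f a))} {q : T (is-just (f b))}
          → a ≡ b → _≡_ {A = Σ A (λ x → T (is-just (f x)))} (a , p) (b , q)
labNode-≡ refl = cong (_ ,_) (T-irrelevant _ _)

fromJust-spec : ∀ {A : Set} (x : Maybe A) (p : T (is-just x)) → x ≡ just (fromJust x p)
fromJust-spec (just _) _ = refl

fromJust-just : ∀ {A : Set} {x : Maybe A} {a : A} → x ≡ just a
              → (p : T (is-just x)) → fromJust x p ≡ a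
fromJust-just refl _ = refl

fromJust-cong : ∀ {A : Set} {x y : Maybe A} (p : T (is-just x)) (q : T (is-just y))
              → x ≡ y → fromJust x p ≡ fromJust y q
fromJust-cong {x = just _} _ _ refl = refl

fromJust-injective : ∀ {A : Set} {x y : Maybe A} (p : T (is-just x)) (q : T (is-just y))
                   → fromJust x p ≡ fromJust y q → x ≡ y
fromJust-injective {x = x} {y} p q eq =
  trans (fromJust-spec x p) (trans (cong just eq) (sym (fromJust-spec y q)))

just⇒is-just : ∀ {A : Set} {x : Maybe A} {a : A} → x ≡ just a → T (is-just x)
just⇒is-just refl = tt

nothing⇒¬is-just : ∀ {A : Set} {x : Maybe A} → x ≡ nothing → ¬ T (is-just x)
nothing⇒¬is-just refl ()

nothing-or-labelled : ∀ {A : Set} (x : Maybe A) → x ≡ nothing ⊎ T (is-just x)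
nothing-or-labelled nothing  = inj₁ refl
nothing-or-labelled (just _) = inj₂ tt

nothing? : ∀ {A : Set} (x : Maybe A) → Dec (x ≡ nothing)
nothing? nothing  = yes refl
nothing? (just _) = no λ ()

labelled : ∀ {A : Set} {x : Maybe A} → ∃[ a ] (x ≡ just a) → T (is-just x)
labelled (_ , eq) = just⇒is-just eq

-- Finite sets: equality and existence are decidable (needed to decide
-- where a node of the result comes from).

finite-≟ : ∀ {A : Set} → Finite A → (x y : A) → Dec (x ≡ y)
finite-≟ (_ , A↔Fin) = inj⇒≟ (↔⇒↣ A↔Fin)

finite-∃? : ∀ {A : Set} → Finite A → {P : A → Set} → (∀ a → Dec (P a)) → Dec (∃ P)
finite-∃? (_ , A↔Fin) {P} P? with any? (λ n → P? (Inverse.from A↔Fin n))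
... | yes (n , p) = yes (Inverse.from A↔Fin n , p)
... | no ¬p = no λ { (a , pa) → ¬p (Inverse.to A↔Fin a ,
                       subst P (sym (Inverse.strictlyInverseʳ A↔Fin a)) pa) }

encMap-isMorphism : ∀ {LV LE : Set} {X Y : Graph LV LE} (f : GMap X Y) (mor : IsMorphism f)
                  → IsMorphism (encMap f mor)
encMap-isMorphism f mor = record
  { pres-s = λ { (inj₁ e) → pres-s e ; (inj₂ _) → refl }
  ; pres-t = λ { (inj₁ e) → pres-t e ; (inj₂ _) → refl }
  ; pres-m = λ { (inj₁ e) → cong inj₂ (pres-m e)
               ; (inj₂ (x , p)) → cong inj₁ (fromJust-just (pres-l x _ (fromJust-spec _ p)) _) }
  ; pres-l = λ _ _ eq → eq
  }
  where open IsMorphism mor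

loop∈image⇒labelled : ∀ {LV LE : Set} {X Y : Graph LV LE} (f : GMap X Y) (f-inj : IsInjMorphism f)
                      {k : V X} {p : T (is-just (l Y (fV f k)))} (x : E (enc X))
                    → fE (encMap f (IsInjMorphism.morphism f-inj)) x ≡ inj₂ (fV f k , p)
                    → T (is-just (l X k))
loop∈image⇒labelled f f-inj (inj₁ _) ()
loop∈image⇒labelled {X = X} f f-inj (inj₂ (k' , q)) eq =
  subst (λ z → T (is-just (l X z))) (IsInjMorphism.injV f-inj (cong proj₁ (inj₂-injective eq))) q

-- A morphism e(X) → e(Y) is the encoding of a morphism X → Y: edge labels
-- force edges to go to edges and loops to loops.
module Decode {LV LE : Set} {X Y : Graph LV LE} (g' : GMap (enc X) (enc Y)) (mor : IsMorphism g') where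
  open IsMorphism mor

  edgeImage : ∀ e → Σ[ e' ∈ E Y ] (fE g' (inj₁ e) ≡ inj₁ e')
  edgeImage e = original (fE g' (inj₁ e)) (pres-m (inj₁ e))
    where
    original : ∀ {c} (y : E (enc Y)) → m (enc Y) y ≡ inj₂ c → Σ[ e' ∈ E Y ] (y ≡ inj₁ e')
    original (inj₁ e') _ = e' , refl
    original (inj₂ _) ()

  loopImage : ∀ x p → Σ[ q ∈ T (is-just (l Y (fV g' x))) ] (fE g' (inj₂ (x , p)) ≡ inj₂ (fV g' x , q))
  loopImage x p = loopAt (fE g' (inj₂ (x , p))) (pres-m (inj₂ (x , p))) (pres-s (inj₂ (x , p)))
    where
    loopAt : ∀ {a z} (y : E (enc Y)) → m (enc Y) y ≡ inj₁ a → s (enc Y) y ≡ z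
           → Σ[ q ∈ T (is-just (l Y z)) ] (y ≡ inj₂ (z , q))
    loopAt (inj₁ _) ()
    loopAt (inj₂ (_ , q)) _ refl = q , refl

  decode : GMap X Y
  decode = gmap (fV g') (λ e → proj₁ (edgeImage e))

  decode-edge : ∀ e → fE g' (inj₁ e) ≡ inj₁ (fE decode e)
  decode-edge e = proj₂ (edgeImage e)

  decode-isMorphism : IsMorphism decode
  decode-isMorphism = record
    { pres-s = λ e → subst (λ y → s (enc Y) y ≡ _) (decode-edge e) (pres-s (inj₁ e))
    ; pres-t = λ e → subst (λ y → t (enc Y) y ≡ _) (decode-edge e) (pres-t (inj₁ e))
    ; pres-m = λ e → inj₂-injective (subst (λ y → m (enc Y) y ≡ _) (decode-edge e) (pres-m (inj₁ e)))
    ; pres-l = labels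
    }
    where
    -- the label of x is read off from the image of its loop
    labels : ∀ x a → l X x ≡ just a → l Y (fV g' x) ≡ just a
    labels x a lx =
      let p = just⇒is-just lx
          (q , loop) = loopImage x p
          sameLabel = subst (λ y → m (enc Y) y ≡ _) loop (pres-m (inj₂ (x , p)))
      in begin
        l Y (fV g' x)              ≡⟨ fromJust-spec _ q ⟩
        just (fromJust _ q)        ≡⟨ cong just (inj₁-injective sameLabel) ⟩
        just (fromJust (l X x) p)  ≡⟨ cong just (fromJust-just lx p) ⟩
        just a                     ∎
      where open ≡-Reasoning

embedEdge : ∀ {A B C D : Set} → A ⊎ B → (A ⊎ C) ⊎ (B ⊎ D)
embedEdge (inj₁ a) = inj₁ (inj₁ a)
embedEdge (inj₂ b) = inj₂ (inj₁ b)

embedEdge-injective : ∀ {A B C D : Set} (x y : A ⊎ B)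
                    → embedEdge {C = C} {D = D} x ≡ embedEdge y → x ≡ y
embedEdge-injective (inj₁ _) (inj₁ _) refl = refl
embedEdge-injective (inj₂ _) (inj₂ _) refl = refl
embedEdge-injective (inj₁ _) (inj₂ _) ()
embedEdge-injective (inj₂ _) (inj₁ _) ()

-- A match g : L → G together with a map g'E on encoded edges sending edges
-- as g does and loops to loops: g' = (g_V, g'E) is then the encoding of g,
-- and all notions of rule application agree for g and g'.
module EncodedMatch {LV LE : Set} (r : Rule LV LE) (isr : IsRule r)
  (G : Graph LV LE) (g : GMap (L r) G) (g'E : E (enc (L r)) → E (enc G))
  (edge↦edge : ∀ e → g'E (inj₁ e) ≡ inj₁ (fE g e))
  (loop↦loop : ∀ x p → ∃[ q ] (g'E (inj₂ (x , p)) ≡ inj₂ (fV g x , q))) where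

  er : Rule ⊤ (LV ⊎ LE)
  er = encRule r isr

  g' : GMap (enc (L r)) (enc G)
  g' = gmap (fV g) g'E

  iV : V (K r) → V (L r)
  iV = fV (i r)

  jV : V (K r) → V (R r)
  jV = fV (j r)

  gV : V (L r) → V G
  gV = fV g

  ResultE : Set
  ResultE = E (enc G) ⊎ E (enc (R r))

  loop↦¬edge : ∀ x p {e} → g'E (inj₂ (x , p)) ≢ inj₁ e
  loop↦¬edge x p eq with () ← trans (sym (proj₂ (loop↦loop x p))) eq

  keptV⇔ : ∀ y → KeptV r G g y ⇔ KeptV er (enc G) g' y
  keptV⇔ (inj₁ _) = mk⇔ (λ k → k) (λ k → k)
  keptV⇔ (inj₂ _) = mk⇔ (λ k → k) (λ k → k)

  keptE⇔ : ∀ x → KeptE r G g x ⇔ KeptE er (enc G) g' (embedEdge x)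
  keptE⇔ (inj₁ e) = mk⇔ encode decode
    where
    encode : ¬ DeletedE r G g e → ¬ DeletedE er (enc G) g' (inj₁ e)
    encode kept (inj₁ y , gy , ¬inK) = kept (y , inj₁-injective (trans (sym (edge↦edge y)) gy) ,
                                              λ k eq → ¬inK (inj₁ k) (cong inj₁ eq))
    encode kept (inj₂ (x , p) , gy , _) = loop↦¬edge x p gy
    decode : ¬ DeletedE er (enc G) g' (inj₁ e) → ¬ DeletedE r G g e
    decode kept (y , gy , ¬inK) = kept (inj₁ y , trans (edge↦edge y) (cong inj₁ gy) ,
      λ { (inj₁ k) eq → ¬inK k (inj₁-injective eq) ; (inj₂ _) () })
  keptE⇔ (inj₂ e) = mk⇔ (λ { kept (inj₁ k) eq → kept k (inj₁-injective eq) ; _ (inj₂ _) () })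
                        (λ kept k eq → kept (inj₁ k) (cong inj₁ eq))

  src-embed : ∀ x y → SrcRel er (enc G) g' (embedEdge x) y ⇔ SrcRel r G g x y
  src-embed (inj₁ _) _ = mk⇔ (λ p → p) (λ p → p)
  src-embed (inj₂ _) _ = mk⇔ (λ p → p) (λ p → p)

  tgt-embed : ∀ x y → TgtRel er (enc G) g' (embedEdge x) y ⇔ TgtRel r G g x y
  tgt-embed (inj₁ _) _ = mk⇔ (λ p → p) (λ p → p)
  tgt-embed (inj₂ _) _ = mk⇔ (λ p → p) (λ p → p)

  edgeLab-embed : ∀ x → edgeLab er (enc G) g' (embedEdge x) ≡ inj₂ (edgeLab r G g x)
  edgeLab-embed (inj₁ _) = refl
  edgeLab-embed (inj₂ _) = refl

  encoded-labels : ∀ y → LabRel er (enc G) g' y (just tt)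
  encoded-labels (inj₁ _) = (λ _ _ ()) , (λ _ → refl)
  encoded-labels (inj₂ _) = refl

  injectiveE-encode : Injective _≡_ _≡_ gV → Injective _≡_ _≡_ (fE g) → Injective _≡_ _≡_ g'E
  injectiveE-encode _ injE {inj₁ a} {inj₁ b} eq =
    cong inj₁ (injE (inj₁-injective (trans (sym (edge↦edge a)) (trans eq (edge↦edge b)))))
  injectiveE-encode _ _ {inj₁ a} {inj₂ (x , p)} eq = ⊥-elim (loop↦¬edge x p (trans (sym eq) (edge↦edge a)))
  injectiveE-encode _ _ {inj₂ (x , p)} {inj₁ b} eq = ⊥-elim (loop↦¬edge x p (trans eq (edge↦edge b)))
  injectiveE-encode injV _ {inj₂ (x , p)} {inj₂ (y , q)} eq =
    cong inj₂ (labNode-≡ (injV (cong proj₁ (inj₂-injective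
      (trans (sym (proj₂ (loop↦loop x p))) (trans eq (proj₂ (loop↦loop y q))))))))

  injectiveE-decode : Injective _≡_ _≡_ g'E → Injective _≡_ _≡_ (fE g)
  injectiveE-decode injE {a} {b} eq =
    inj₁-injective (injE (trans (edge↦edge a) (trans (cong inj₁ eq) (sym (edge↦edge b)))))

  module _ (totL : TotallyLabelled (L r)) where

    deletedV⇒loopDeleted : ∀ {u} p → DeletedV r G g u → DeletedE er (enc G) g' (inj₂ (u , p))
    deletedV⇒loopDeleted p (x , gx , ¬inK) =
      inj₂ (x , labelled (totL x)) ,
      trans (proj₂ (loop↦loop x _)) (cong inj₂ (labNode-≡ gx)) ,
      λ { (inj₁ _) () ; (inj₂ (k , _)) eq → ¬inK k (cong proj₁ (inj₂-injective eq)) }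

    unlabelled⇒loopDeleted : ∀ {k} p → l (K r) k ≡ nothing
                           → DeletedE er (enc G) g' (inj₂ (gV (iV k) , p))
    unlabelled⇒loopDeleted {k} p lk =
      inj₂ (iV k , labelled (totL (iV k))) ,
      trans (proj₂ (loop↦loop (iV k) _)) (cong inj₂ (labNode-≡ refl)) ,
      λ k' eq → nothing⇒¬is-just lk (loop∈image⇒labelled (i r) (proj₁ isr) k' eq)

    dangling⇔ : Dangling r G g ⇔ Dangling er (enc G) g'
    dangling⇔ = mk⇔ encode decode
      where
      encode : Dangling r G g → Dangling er (enc G) g'
      encode dangling (inj₁ e) ∉img = dangling e (λ x eq → ∉img (inj₁ x) (trans (edge↦edge x) (cong inj₁ eq)))
      encode dangling (inj₂ (v , p)) ∉img = ¬deleted , ¬deleted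
        where
        ¬deleted : ¬ DeletedV r G g v
        ¬deleted del = let (x , gx , _) = deletedV⇒loopDeleted p del in ∉img x gx
      decode : Dangling er (enc G) g' → Dangling r G g
      decode dangling e ∉img = dangling (inj₁ e) ∉img'
        where
        ∉img' : ∀ x → g'E x ≢ inj₁ e
        ∉img' (inj₁ x) eq = ∉img x (inj₁-injective (trans (sym (edge↦edge x)) eq))
        ∉img' (inj₂ (x , p)) eq = loop↦¬edge x p eq

module Forward {LV LE : Set} (r : Rule LV LE) (isr : IsRule r)
  (finKV : Finite (V (K r))) (finRV : Finite (V (R r)))
  (totL : TotallyLabelled (L r)) (totR : TotallyLabelled (R r))
  (G H : Graph LV LE) (finGV : Finite (V G))
  (totG : TotallyLabelled G) (totH : TotallyLabelled H)
  (D : G ⇒[ r ] H) where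

  open _⇒[_]_ D
  open EncodedMatch r isr G g (fE (encMap g g-mor)) (λ _ → refl) (λ _ _ → _ , refl)

  Relabelled : V G → Set
  Relabelled u = ∃[ k ] (gV (iV k) ≡ u × l (K r) k ≡ nothing)

  relabelled? : ∀ u → Dec (Relabelled u)
  relabelled? u = finite-∃? finKV (λ k → finite-≟ finGV (gV (iV k)) u ×-dec nothing? (l (K r) k))

  -- where a node of H comes from, refined by where its label comes from
  data Origin (v : V H) : Set where
    new        : (w : V (R r)) → φV v ≡ inj₂ w → Origin v
    relabelled : (k : V (K r)) → φV v ≡ inj₁ (gV (iV k)) → l (K r) k ≡ nothing → Origin v
    preserved  : (u : V G) → φV v ≡ inj₁ u → ¬ Relabelled u → Origin v

  origin : ∀ v → Origin v
  origin v with φV v in eq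
  ... | inj₂ w = new w eq
  ... | inj₁ u with relabelled? u
  ...   | yes (k , gik , lk) = relabelled k (trans eq (cong inj₁ (sym gik))) lk
  ...   | no ¬rel = preserved u eq ¬rel

  new∉K : ∀ {v w} → φV v ≡ inj₂ w → ∀ k → jV k ≢ w
  new∉K {v} eq = subst (KeptV r G g) eq (φV-into v)

  old∉deleted : ∀ {v u} → φV v ≡ inj₁ u → ¬ DeletedV r G g u
  old∉deleted {v} eq = subst (KeptV r G g) eq (φV-into v)

  labelAt : ∀ {v y} → φV v ≡ y → LabRel r G g y (l H v)
  labelAt {v} eq = subst (λ y → LabRel r G g y (l H v)) eq (φ-l v)

  loopOf : ∀ {v} → Origin v → ResultE
  loopOf (new w _)          = inj₂ (inj₂ (w , labelled (totR w)))
  loopOf (relabelled k _ _) = inj₂ (inj₂ (jV k , labelled (totR (jV k))))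
  loopOf (preserved u _ _)  = inj₁ (inj₂ (u , labelled (totG u)))

  -- edge part of the isomorphism e(H) ≅ result: edges of H are embedded,
  -- the loop at v goes to the loop carrying v's label
  φE' : E (enc H) → ResultE
  φE' (inj₁ e) = embedEdge (φE e)
  φE' (inj₂ (v , _)) = loopOf (origin v)

  loopR-node : ∀ {w w' p q} → _≡_ {A = ResultE} (inj₂ (inj₂ (w , p))) (inj₂ (inj₂ (w' , q))) → w ≡ w'
  loopR-node eq = cong proj₁ (inj₂-injective (inj₂-injective eq))

  loopOf-injective : ∀ {v u} (c : Origin v) (d : Origin u) → loopOf c ≡ loopOf d → v ≡ u
  loopOf-injective (new w eq) (new w' eq') same =
    φV-inj (trans eq (trans (cong inj₂ (loopR-node same)) (sym eq')))
  loopOf-injective (new w eq) (relabelled k _ _) same = ⊥-elim (new∉K eq k (sym (loopR-node same)))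
  loopOf-injective (relabelled k _ _) (new w eq) same = ⊥-elim (new∉K eq k (loopR-node same))
  loopOf-injective (relabelled k eq _) (relabelled k' eq' _) same =
    φV-inj (trans eq (trans (cong (λ z → inj₁ (gV (iV z))) (IsInjMorphism.injV (proj₂ isr) (loopR-node same)))
                            (sym eq')))
  loopOf-injective (preserved u eq _) (preserved u' eq' _) same =
    φV-inj (trans eq (trans (cong inj₁ (cong proj₁ (inj₂-injective (inj₁-injective same)))) (sym eq')))
  loopOf-injective (new _ _) (preserved _ _ _) ()
  loopOf-injective (relabelled _ _ _) (preserved _ _ _) ()
  loopOf-injective (preserved _ _ _) (new _ _) ()
  loopOf-injective (preserved _ _ _) (relabelled _ _ _) ()

  embed≢loop : ∀ x {v} (c : Origin v) → embedEdge x ≢ loopOf c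
  embed≢loop (inj₁ _) (new _ _) ()
  embed≢loop (inj₁ _) (relabelled _ _ _) ()
  embed≢loop (inj₁ _) (preserved _ _ _) ()
  embed≢loop (inj₂ _) (new _ _) ()
  embed≢loop (inj₂ _) (relabelled _ _ _) ()
  embed≢loop (inj₂ _) (preserved _ _ _) ()

  φE'-injective : Injective _≡_ _≡_ φE'
  φE'-injective {inj₁ a} {inj₁ b} eq = cong inj₁ (φE-inj (embedEdge-injective _ _ eq))
  φE'-injective {inj₁ a} {inj₂ (v , _)} eq = ⊥-elim (embed≢loop (φE a) (origin v) eq)
  φE'-injective {inj₂ (v , _)} {inj₁ b} eq = ⊥-elim (embed≢loop (φE b) (origin v) (sym eq))
  φE'-injective {inj₂ (v , _)} {inj₂ (u , _)} eq =
    cong inj₂ (labNode-≡ (loopOf-injective (origin v) (origin u) eq))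

  loopOf-kept : ∀ {v} (c : Origin v) → KeptE er (enc G) g' (loopOf c)
  loopOf-kept (new w eq) (inj₁ _) ()
  loopOf-kept (new w eq) (inj₂ (k , _)) jk = new∉K eq k (cong proj₁ (inj₂-injective jk))
  loopOf-kept (relabelled k _ lk) k' jk =
    nothing⇒¬is-just lk (loop∈image⇒labelled (j r) (proj₂ isr) k' jk)
  loopOf-kept (preserved u _ _) (inj₁ _ , () , _)
  loopOf-kept (preserved u eq ¬rel) (inj₂ (x , _) , gx , ¬inK) =
    old∉deleted eq (x , gx=u , x∉iK)
    where
    gx=u : gV x ≡ u
    gx=u = cong proj₁ (inj₂-injective gx)
    -- an unlabelled interface node would make u relabelled, a labelled one
    -- would put the loop at x into e(K)
    x∉iK : ∀ k → iV k ≢ x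
    x∉iK k ik with nothing-or-labelled (l (K r) k)
    ... | inj₁ lk = ¬rel (k , trans (cong gV ik) gx=u , lk)
    ... | inj₂ p  = ¬inK (inj₂ (k , p)) (cong inj₂ (labNode-≡ ik))

  φE'-kept : ∀ e → KeptE er (enc G) g' (φE' e)
  φE'-kept (inj₁ e) = to (keptE⇔ (φE e)) (φE-into e)
  φE'-kept (inj₂ (v , _)) = loopOf-kept (origin v)

  loopOf-src : ∀ {v} (c : Origin v) → SrcRel er (enc G) g' (loopOf c) (φV v)
  loopOf-src (new w eq)          = inj₂ (new∉K eq , eq)
  loopOf-src (relabelled k eq _) = inj₁ (k , refl , eq)
  loopOf-src (preserved u eq _)  = eq

  loopOf-tgt : ∀ {v} (c : Origin v) → TgtRel er (enc G) g' (loopOf c) (φV v)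
  loopOf-tgt (new w eq)          = inj₂ (new∉K eq , eq)
  loopOf-tgt (relabelled k eq _) = inj₁ (k , refl , eq)
  loopOf-tgt (preserved u eq _)  = eq

  loopOf-label : ∀ {v} (p : T (is-just (l H v))) (c : Origin v)
               → inj₁ (fromJust (l H v) p) ≡ edgeLab er (enc G) g' (loopOf c)
  loopOf-label p (new w eq) = cong inj₁ (fromJust-cong p _ (labelAt eq))
  loopOf-label p (relabelled k eq lk) = cong inj₁ (fromJust-cong p _ (proj₁ (labelAt eq) k refl lk))
  loopOf-label p (preserved u eq ¬rel) = cong inj₁ (fromJust-cong p _ (proj₂ (labelAt eq) ¬rel))

  φE'-label : ∀ e → m (enc H) e ≡ edgeLab er (enc G) g' (φE' e)
  φE'-label (inj₁ e) = trans (cong inj₂ (φ-m e)) (sym (edgeLab-embed (φE e)))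
  φE'-label (inj₂ (v , p)) = loopOf-label p (origin v)

  onto-embedded : ∀ x → KeptE er (enc G) g' (embedEdge x) → ∃[ e ] (φE' e ≡ embedEdge x)
  onto-embedded x kept = let (e , eq) = φE-onto x (from (keptE⇔ x) kept) in inj₁ e , cong embedEdge eq

  onto-loopG : ∀ u p → KeptE er (enc G) g' (inj₁ (inj₂ (u , p))) → ∃[ e ] (φE' e ≡ inj₁ (inj₂ (u , p)))
  onto-loopG u p kept =
    let (v , φv) = φV-onto (inj₁ u) (λ del → kept (deletedV⇒loopDeleted totL p del))
    in inj₂ (v , labelled (totH v)) , loop (origin v) φv
    where
    loop : ∀ {v} (c : Origin v) → φV v ≡ inj₁ u → loopOf c ≡ inj₁ (inj₂ (u , p))
    loop (new _ eq) φv with () ← trans (sym eq) φv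
    loop (relabelled k eq lk) φv with refl ← inj₁-injective (trans (sym eq) φv) =
      ⊥-elim (kept (unlabelled⇒loopDeleted totL p lk))
    loop (preserved _ eq _) φv = cong (λ z → inj₁ (inj₂ z)) (labNode-≡ (inj₁-injective (trans (sym eq) φv)))

  onto-loopR : ∀ w q → KeptE er (enc G) g' (inj₂ (inj₂ (w , q))) → ∃[ e ] (φE' e ≡ inj₂ (inj₂ (w , q)))
  onto-loopR w q kept with finite-∃? finKV (λ k → finite-≟ finRV (jV k) w)
  ... | yes (k , jk) with nothing-or-labelled (l (K r) k)
  ...   | inj₂ p = ⊥-elim (kept (inj₂ (k , p)) (cong inj₂ (labNode-≡ jk)))
  ...   | inj₁ lk =
    let (v , φv) = φV-onto (inj₁ (gV (iV k))) λ { (x , gx , ¬inK) → ¬inK k (sym (g-injV gx)) }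
    in inj₂ (v , labelled (totH v)) , loop (origin v) φv
    where
    loop : ∀ {v} (c : Origin v) → φV v ≡ inj₁ (gV (iV k)) → loopOf c ≡ inj₂ (inj₂ (w , q))
    loop (new _ eq) φv with () ← trans (sym eq) φv
    loop (relabelled k' eq _) φv =
      cong (λ z → inj₂ (inj₂ z)) (labNode-≡ (trans (cong jV (IsInjMorphism.injV (proj₁ isr)
        (g-injV (inj₁-injective (trans (sym eq) φv))))) jk))
    loop (preserved _ eq ¬rel) φv = ⊥-elim (¬rel (k , sym (inj₁-injective (trans (sym eq) φv)) , lk))
  onto-loopR w q kept | no w∉jK =
    let (v , φv) = φV-onto (inj₂ w) (λ k jk → w∉jK (k , jk))
    in inj₂ (v , labelled (totH v)) , loop (origin v) φv
    where
    loop : ∀ {v} (c : Origin v) → φV v ≡ inj₂ w → loopOf c ≡ inj₂ (inj₂ (w , q))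
    loop (new _ eq) φv = cong (λ z → inj₂ (inj₂ z)) (labNode-≡ (inj₂-injective (trans (sym eq) φv)))
    loop (relabelled _ eq _) φv with () ← trans (sym eq) φv
    loop (preserved _ eq _) φv with () ← trans (sym eq) φv

  φE'-onto : ∀ x → KeptE er (enc G) g' x → ∃[ e ] (φE' e ≡ x)
  φE'-onto (inj₁ (inj₁ e)) = onto-embedded (inj₁ e)
  φE'-onto (inj₂ (inj₁ e)) = onto-embedded (inj₂ e)
  φE'-onto (inj₁ (inj₂ (u , p))) = onto-loopG u p
  φE'-onto (inj₂ (inj₂ (w , q))) = onto-loopR w q

  result : enc G ⇒[ encRule r isr ] enc H
  result = record
    { total    = λ _ → tt , refl
    ; g        = g'
    ; g-mor    = encMap-isMorphism g g-mor
    ; g-injV   = g-injV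
    ; g-injE   = injectiveE-encode g-injV g-injE
    ; dangling = to (dangling⇔ totL) dangling
    ; φV       = φV
    ; φE       = φE'
    ; φV-inj   = φV-inj
    ; φE-inj   = φE'-injective
    ; φV-onto  = λ y kept → φV-onto y (from (keptV⇔ y) kept)
    ; φV-into  = λ v → to (keptV⇔ (φV v)) (φV-into v)
    ; φE-onto  = φE'-onto
    ; φE-into  = φE'-kept
    ; φ-s      = λ { (inj₁ e) → from (src-embed (φE e) _) (φ-s e) ; (inj₂ (v , _)) → loopOf-src (origin v) }
    ; φ-t      = λ { (inj₁ e) → from (tgt-embed (φE e) _) (φ-t e) ; (inj₂ (v , _)) → loopOf-tgt (origin v) }
    ; φ-l      = λ v → encoded-labels (φV v)
    ; φ-m      = φE'-label
    }

module Backward {LV LE : Set} (r : Rule LV LE) (isr : IsRule r)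
  (totL : TotallyLabelled (L r)) (G H : Graph LV LE)
  (totG : TotallyLabelled G) (totH : TotallyLabelled H)
  (D : enc G ⇒[ encRule r isr ] enc H) where

  module D = _⇒[_]_ D
  open Decode D.g D.g-mor
  open EncodedMatch r isr G decode (fE D.g) decode-edge loopImage

  LE-labelled⇒embedded : ∀ {c} (y : ResultE) → edgeLab er (enc G) g' y ≡ inj₂ c
                       → Σ[ x ∈ E G ⊎ E (R r) ] (y ≡ embedEdge x)
  LE-labelled⇒embedded (inj₁ (inj₁ e)) _ = inj₁ e , refl
  LE-labelled⇒embedded (inj₂ (inj₁ e)) _ = inj₂ e , refl
  LE-labelled⇒embedded (inj₁ (inj₂ _)) ()
  LE-labelled⇒embedded (inj₂ (inj₂ _)) ()

  -- edges of H are sent to embedded edges, since their labels lie in LE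
  φE : E H → E G ⊎ E (R r)
  φE e = proj₁ (LE-labelled⇒embedded (D.φE (inj₁ e)) (sym (D.φ-m (inj₁ e))))

  φE-spec : ∀ e → D.φE (inj₁ e) ≡ embedEdge (φE e)
  φE-spec e = proj₂ (LE-labelled⇒embedded (D.φE (inj₁ e)) (sym (D.φ-m (inj₁ e))))

  φE-injective : Injective _≡_ _≡_ φE
  φE-injective {a} {b} eq = inj₁-injective (D.φE-inj (trans (φE-spec a) (trans (cong embedEdge eq) (sym (φE-spec b)))))

  φE-onto : ∀ x → KeptE r G decode x → ∃[ e ] (φE e ≡ x)
  φE-onto x kept with D.φE-onto (embedEdge x) (to (keptE⇔ x) kept)
  ... | inj₁ e , eq = e , embedEdge-injective _ _ (trans (sym (φE-spec e)) eq)
  ... | inj₂ (v , p) , eq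
    with () ← trans (D.φ-m (inj₂ (v , p))) (trans (cong (edgeLab er (enc G) g') eq) (edgeLab-embed x))

  -- The label of a node of H is carried by the (kept) image of its loop,
  -- which is attached at the image of the node.
  labelFromLoop : ∀ {h : Maybe LV} (p : T (is-just h)) (z : V G ⊎ V (R r)) (y : ResultE)
                → SrcRel er (enc G) g' y z
                → inj₁ (fromJust h p) ≡ edgeLab er (enc G) g' y → KeptE er (enc G) g' y
                → LabRel r G decode z h
  labelFromLoop p _ (inj₁ (inj₁ _)) _ () _
  labelFromLoop p _ (inj₂ (inj₁ _)) _ () _
  labelFromLoop p _ (inj₁ (inj₂ (u , q))) refl lab kept =
    (λ k gik lk → ⊥-elim (kept (subst (λ z → DeletedE er (enc G) g' (inj₂ z))
                                       (labNode-≡ gik) (unlabelled⇒loopDeleted totL (labelled (totG _)) lk)))) ,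
    (λ _ → fromJust-injective p q (inj₁-injective lab))
  labelFromLoop p _ (inj₂ (inj₂ (w , q))) (inj₂ (_ , refl)) lab kept =
    fromJust-injective p q (inj₁-injective lab)
  labelFromLoop {h} p _ (inj₂ (inj₂ (w , q))) (inj₁ (k , jk , refl)) lab kept =
    relabelled , preserved
    where
    relabelled : ∀ k' → fV decode (iV k') ≡ fV decode (iV k) → l (K r) k' ≡ nothing → h ≡ l (R r) (jV k')
    relabelled k' gik _ = trans (fromJust-injective p q (inj₁-injective lab))
      (cong (l (R r)) (trans (sym jk) (cong jV (sym (IsInjMorphism.injV (proj₁ isr) (D.g-injV gik))))))
    -- k must be unlabelled, otherwise the loop at w would lie in e(K)
    preserved : ¬ (∃[ k' ] (fV decode (iV k') ≡ fV decode (iV k) × l (K r) k' ≡ nothing))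
              → h ≡ l G (fV decode (iV k))
    preserved ¬rel with nothing-or-labelled (l (K r) k)
    ... | inj₁ lk = ⊥-elim (¬rel (k , refl , lk))
    ... | inj₂ lab-k = ⊥-elim (kept (inj₂ (k , lab-k)) (cong inj₂ (labNode-≡ jk)))

  labels : ∀ v → LabRel r G decode (D.φV v) (l H v)
  labels v = labelFromLoop p (D.φV v) (D.φE loop) (D.φ-s loop) (D.φ-m loop) (D.φE-into loop)
    where
    p : T (is-just (l H v))
    p = labelled (totH v)
    loop : E (enc H)
    loop = inj₂ (v , p)

  result : G ⇒[ r ] H
  result = record
    { total    = totG
    ; g        = decode
    ; g-mor    = decode-isMorphism
    ; g-injV   = D.g-injV
    ; g-injE   = injectiveE-decode D.g-injE
    ; dangling = from (dangling⇔ totL) D.dangling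
    ; φV       = D.φV
    ; φE       = φE
    ; φV-inj   = D.φV-inj
    ; φE-inj   = φE-injective
    ; φV-onto  = λ y kept → D.φV-onto y (to (keptV⇔ y) kept)
    ; φV-into  = λ v → from (keptV⇔ (D.φV v)) (D.φV-into v)
    ; φE-onto  = φE-onto
    ; φE-into  = λ e → from (keptE⇔ (φE e)) (subst (KeptE er (enc G) g') (φE-spec e) (D.φE-into (inj₁ e)))
    ; φ-s      = λ e → to (src-embed (φE e) _)
                         (subst (λ y → SrcRel er (enc G) g' y _) (φE-spec e) (D.φ-s (inj₁ e)))
    ; φ-t      = λ e → to (tgt-embed (φE e) _)
                         (subst (λ y → TgtRel er (enc G) g' y _) (φE-spec e) (D.φ-t (inj₁ e)))
    ; φ-l      = labels
    ; φ-m      = λ e → inj₂-injective (trans (D.φ-m (inj₁ e))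
                         (trans (cong (edgeLab er (enc G) g') (φE-spec e)) (edgeLab-embed (φE e))))
    }

mainTheorem18 : {LV LE : Set} → Finite LV → Finite LE
    → (r : Rule LV LE) (isr : IsRule r)
    → FiniteGraph (L r) → FiniteGraph (K r) → FiniteGraph (R r)
    → TotallyLabelled (L r) → TotallyLabelled (R r)
    → (G H : Graph LV LE) → FiniteGraph G → FiniteGraph H
    → TotallyLabelled G → TotallyLabelled H
    → (G ⇒[ r ] H) ⇔ (enc G ⇒[ encRule r isr ] enc H)
mainTheorem18 _ _ r isr _ (finKV , _) (finRV , _) totL totR G H (finGV , _) _ totG totH =
  mk⇔ (Forward.result r isr finKV finRV totL totR G H finGV totG totH)
      (Backward.result r isr totL G H totG totH)
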